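{- Let $q\geq 3$ be odd, let $D$ be the dihedral group of order $2q$, $G\subseteq D$ its subgroup of order $q$. Let $B$ be a $D$-module (written additively) such that $B[q]=B[q]^G$. Then the map induced by the inclusion $B[q]\subseteq B$ satisfies \[ \ker\bigl(\hat H^{ -1}(G,B[q])\to\hat H^{ -1}(G,B)\bigr)=I_GB\cap B[q]^G=I_GB\cap B^G, \] where $\hat H^{ -1}(G,B[q])$ is identified with $B[q]$. If moreover $B$ is uniquely $2$-divisible, then \[ \ker\bigl(\hat H^{ -1}(D,B[q])\to\hat H^{ -1}(D,B)\bigr)=I_GB\cap B[q]^D=I_GB\cap B^D. \]
   Context: $B[q]=\{b\in B: qb=0\}$; $B^H$ denotes $H$-invariants; $I_G$ is the augmentation ideal of $\mathbb Z[G]$. Uniquely $2$-divisible means multiplication by $2$ is an automorphism. $\hat H^{ -1}$ is Tate cohomology; since $G$ acts trivially on $B[q]$ and $N_G$ acts as $q$, one has $\hat H^{ -1}(G,B[q])=B[q]$, and in the uniquely $2$-divisible case $\hat H^{ -1}(D,B[q])$ is identified with $B[q]^D$ via restriction to $G$. -}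

module Defs where

open import Level using (Level; _⊔_) renaming (suc to lsuc)
open import Algebra.Bundles using (AbelianGroup)
open import Data.Nat using (ℕ; zero; suc; _∸_)
open import Data.Bool using (Bool; true; false; if_then_else_)
open import Data.Fin using (Fin; toℕ)
open import Data.Product using (Σ; ∃; _×_; _,_)
open import Data.List using (List; []; _∷_; map; foldr; allFin; _++_)

iter : ∀ {a} {A : Set a} → ℕ → (A → A) → A → A
iter zero    f x = x
iter (suc n) f x = f (iter n f x)

-- A module over the dihedral group D = ⟨ r , s | r^q = s^2 = 1, s r s = r^{-1} ⟩
-- of order 2q: an abelian group B together with additive endomorphisms
-- ρ (action of the rotation r) and σ (action of the reflection s)
-- satisfying the defining relations of D.
-- The elements of D are r^i s^e with i : Fin q, e : Bool; the subgroup
-- G of order q is the rotation subgroup {r^i : i : Fin q}.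
record DihedralModule (q : ℕ) (c ℓ : Level) : Set (lsuc (c ⊔ ℓ)) where
  field
    B : AbelianGroup c ℓ
  open AbelianGroup B public
  field
    ρ σ    : Carrier → Carrier
    ρ-cong : ∀ {x y} → x ≈ y → ρ x ≈ ρ y
    σ-cong : ∀ {x y} → x ≈ y → σ x ≈ σ y
    ρ-hom  : ∀ x y → ρ (x ∙ y) ≈ ρ x ∙ ρ y
    σ-hom  : ∀ x y → σ (x ∙ y) ≈ σ x ∙ σ y
    ρ^q    : ∀ x → iter q ρ x ≈ x
    σ²     : ∀ x → σ (σ x) ≈ x
    σρσ    : ∀ x → σ (ρ (σ x)) ≈ iter (q ∸ 1) ρ x

  actG : Fin q → Carrier → Carrier
  actG i x = iter (toℕ i) ρ x

  actD : Fin q × Bool → Carrier → Carrier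
  actD (i , e) x = iter (toℕ i) ρ (if e then σ x else x)

  elemsG : List (Fin q)
  elemsG = allFin q

  elemsD : List (Fin q × Bool)
  elemsD = map (λ i → i , false) (allFin q) ++ map (λ i → i , true) (allFin q)

  sumL : List Carrier → Carrier
  sumL = foldr _∙_ ε

  mul : ℕ → Carrier → Carrier
  mul zero    x = ε
  mul (suc n) x = x ∙ mul n x

  InBq : Carrier → Set ℓ
  InBq x = mul q x ≈ ε

  InvG : Carrier → Set ℓ
  InvG x = ∀ (g : Fin q) → actG g x ≈ x

  InvD : Carrier → Set ℓ
  InvD x = ∀ (d : Fin q × Bool) → actD d x ≈ x

  InIGB : Carrier → Set (c ⊔ ℓ)
  InIGB x = Σ (List (Fin q × Carrier)) λ l →
              x ≈ sumL (map (λ { (g , b) → actG g b ∙ b ⁻¹ }) l)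

  InIDB : Carrier → Set (c ⊔ ℓ)
  InIDB x = Σ (List ((Fin q × Bool) × Carrier)) λ l →
              x ≈ sumL (map (λ { (d , b) → actD d b ∙ b ⁻¹ }) l)

  NG : Carrier → Carrier
  NG x = sumL (map (λ g → actG g x) elemsG)

  ND : Carrier → Carrier
  ND x = sumL (map (λ d → actD d x) elemsD)

  -- Ĥ^{-1}(H,M) = ker(N_H on M) / I_H M; the class of a cycle m is zero
  -- in Ĥ^{-1}(H,B) iff m ∈ I_H B.
  --
  -- Kernel of Ĥ^{-1}(G,B[q]) → Ĥ^{-1}(G,B), with Ĥ^{-1}(G,B[q]) identified
  -- with B[q]: the elements x ∈ B[q] whose class in Ĥ^{-1}(G,B) is zero.
  KerG : Carrier → Set (c ⊔ ℓ)
  KerG x = InBq x × InIGB x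

  -- Restriction Ĥ^{-1}(D,M) → Ĥ^{-1}(G,M) on representatives:
  -- m ↦ Σ_{t ∈ G\D} t m = m + s m.
  resDG : Carrier → Carrier
  resDG x = x ∙ σ x

  -- Kernel of Ĥ^{-1}(D,B[q]) → Ĥ^{-1}(D,B), transported along the
  -- identification of Ĥ^{-1}(D,B[q]) with B[q]^D via restriction to G:
  -- the images res(b) of the cycles b ∈ B[q] (N_D b = 0) whose class in
  -- Ĥ^{-1}(D,B) is zero, i.e. b ∈ I_D B.
  KerD : Carrier → Set (c ⊔ ℓ)
  KerD x = Σ Carrier λ b → (InBq b × ND b ≈ ε × InIDB b) × resDG b ≈ x

  Uniquely2Divisible : Set (c ⊔ ℓ)
  Uniquely2Divisible = (∀ y → Σ Carrier λ x → x ∙ x ≈ y)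
                     × (∀ x y → x ∙ x ≈ y ∙ y → x ≈ y)

{-# OPTIONS --safe #-}
-- The orbit sum y + ρ y + ⋯ + ρ^(q-1) y is ρ-invariant, hence kills I_G B, while on Bᴳ it is
-- multiplication by q; so I_G B ∩ Bᴳ ⊆ B[q]. Since s rⁱ s ∈ G, the restriction b ↦ b + s b
-- maps I_D B into I_G B; conversely, if B is uniquely 2-divisible, x ∈ I_G B ∩ Bᴰ is the
-- restriction of x/2, and x/2 ∈ I_D B.
module Submission where

open import Defs
open import Level using (Level; _⊔_)
open import Data.Nat using (ℕ; zero; suc; _+_; _*_; _∸_; _≤_; _<_; z<s)
open import Data.Nat.Divisibility using (_∣_)
open import Data.Nat.Properties using (≤-trans; <-trans; n≤1+n)
open import Data.Bool using (true; false)
open import Data.Fin using (toℕ; fromℕ<)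
open import Data.Fin.Properties using (toℕ-fromℕ<)
open import Data.List using (List; []; _∷_; [_]; map; length; _++_; allFin)
open import Data.List.Properties using (map-++; length-++; length-map; length-tabulate)
open import Data.Product using (Σ; _×_; _,_; proj₁; proj₂)
open import Function.Base using (id; _∘_)
open import Function.Bundles using (_⇔_; mk⇔)
import Relation.Binary.PropositionalEquality as ≡
open import Relation.Nullary using (¬_)
import Algebra.Properties.AbelianGroup as AbelianGroupProperties
import Algebra.Properties.CommutativeSemigroup as CommutativeSemigroupProperties

iter-+ : ∀ {a} {A : Set a} (f : A → A) m n x → iter (m + n) f x ≡.≡ iter m f (iter n f x)
iter-+ f zero    n x = ≡.refl
iter-+ f (suc m) n x = ≡.cong f (iter-+ f m n x)

iter-suc : ∀ {a} {A : Set a} (f : A → A) n x → iter n f (f x) ≡.≡ f (iter n f x)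
iter-suc f zero    x = ≡.refl
iter-suc f (suc n) x = ≡.cong f (iter-suc f n x)

module DihedralModuleProperties {c ℓ : Level} {q : ℕ} (M : DihedralModule q c ℓ) where

  open DihedralModule M
  open AbelianGroupProperties B
  open CommutativeSemigroupProperties commutativeSemigroup using (interchange)
  open import Relation.Binary.Reasoning.Setoid setoid

  ≡⇒≈ : ∀ {x y} → x ≡.≡ y → x ≈ y
  ≡⇒≈ ≡.refl = refl

  telescope : ∀ a b c → (b ∙ a ⁻¹) ∙ (c ∙ b ⁻¹) ≈ c ∙ a ⁻¹
  telescope a b c = begin
    (b ∙ a ⁻¹) ∙ (c ∙ b ⁻¹)   ≈⟨ comm _ _ ⟩
    (c ∙ b ⁻¹) ∙ (b ∙ a ⁻¹)   ≈⟨ assoc _ _ _ ⟩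
    c ∙ (b ⁻¹ ∙ (b ∙ a ⁻¹))   ≈⟨ ∙-congˡ (assoc _ _ _) ⟨
    c ∙ ((b ⁻¹ ∙ b) ∙ a ⁻¹)   ≈⟨ ∙-congˡ (∙-congʳ (inverseˡ b)) ⟩
    c ∙ (ε ∙ a ⁻¹)            ≈⟨ ∙-congˡ (identityˡ _) ⟩
    c ∙ a ⁻¹                  ∎

  sumL-++ : ∀ l m → sumL (l ++ m) ≈ sumL l ∙ sumL m
  sumL-++ []      m = sym (identityˡ _)
  sumL-++ (a ∷ l) m = trans (∙-congˡ (sumL-++ l m)) (sym (assoc _ _ _))

  sumL-map-closed : ∀ {a p} {A : Set a} (P : Carrier → Set p) →
                    P ε → (∀ {x y} → P x → P y → P (x ∙ y)) →
                    {f : A → Carrier} → (∀ a → P (f a)) → ∀ l → P (sumL (map f l))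
  sumL-map-closed P Pε P∙ Pf []      = Pε
  sumL-map-closed P Pε P∙ Pf (a ∷ l) = P∙ (Pf a) (sumL-map-closed P Pε P∙ Pf l)

  mul-+ : ∀ m n x → mul (m + n) x ≈ mul m x ∙ mul n x
  mul-+ zero    n x = sym (identityˡ _)
  mul-+ (suc m) n x = trans (∙-congˡ (mul-+ m n x)) (sym (assoc _ _ _))

  sumL-map-const : ∀ {a} {A : Set a} {f : A → Carrier} {b} →
                   (∀ a → f a ≈ b) → ∀ l → sumL (map f l) ≈ mul (length l) b
  sumL-map-const f≈b []      = refl
  sumL-map-const f≈b (a ∷ l) = ∙-cong (f≈b a) (sumL-map-const f≈b l)

  record IsEndomorphism (f : Carrier → Carrier) : Set (c ⊔ ℓ) where
    field
      cong : ∀ {x y} → x ≈ y → f x ≈ f y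
      homo : ∀ x y → f (x ∙ y) ≈ f x ∙ f y

    ε-homo : f ε ≈ ε
    ε-homo = ∙-cancelˡ (f ε) (f ε) ε (begin
      f ε ∙ f ε   ≈⟨ homo ε ε ⟨
      f (ε ∙ ε)   ≈⟨ cong (identityʳ ε) ⟩
      f ε         ≈⟨ identityʳ (f ε) ⟨
      f ε ∙ ε     ∎)

    ⁻¹-homo : ∀ x → f (x ⁻¹) ≈ f x ⁻¹
    ⁻¹-homo x = inverseˡ-unique (f (x ⁻¹)) (f x)
      (trans (sym (homo (x ⁻¹) x)) (trans (cong (inverseˡ x)) ε-homo))

    ∙⁻¹-homo : ∀ x y → f (x ∙ y ⁻¹) ≈ f x ∙ f y ⁻¹
    ∙⁻¹-homo x y = trans (homo x (y ⁻¹)) (∙-congˡ (⁻¹-homo y))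

    mul-homo : ∀ n x → f (mul n x) ≈ mul n (f x)
    mul-homo zero    x = ε-homo
    mul-homo (suc n) x = trans (homo x (mul n x)) (∙-congˡ (mul-homo n x))

    sumL-map-homo : ∀ {a} {A : Set a} (g : A → Carrier) l →
                    f (sumL (map g l)) ≈ sumL (map (f ∘ g) l)
    sumL-map-homo g []      = ε-homo
    sumL-map-homo g (a ∷ l) = trans (homo _ _) (∙-congˡ (sumL-map-homo g l))

  open IsEndomorphism

  id-endo : IsEndomorphism id
  id-endo = record { cong = id ; homo = λ _ _ → refl }

  ε-endo : IsEndomorphism (λ _ → ε)
  ε-endo = record { cong = λ _ → refl ; homo = λ _ _ → sym (identityʳ ε) }

  ∙-endo : ∀ {f g} → IsEndomorphism f → IsEndomorphism g → IsEndomorphism (λ x → f x ∙ g x)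
  ∙-endo F G = record
    { cong = λ x≈y → ∙-cong (cong F x≈y) (cong G x≈y)
    ; homo = λ x y → trans (∙-cong (homo F x y) (homo G x y)) (interchange _ _ _ _)
    }

  iter-endo : ∀ {f} → IsEndomorphism f → ∀ n → IsEndomorphism (iter n f)
  iter-endo F zero    = id-endo
  iter-endo F (suc n) = record
    { cong = cong F ∘ cong (iter-endo F n)
    ; homo = λ x y → trans (cong F (homo (iter-endo F n) x y)) (homo F _ _)
    }

  mul-endo : ∀ n → IsEndomorphism (mul n)
  mul-endo zero    = ε-endo
  mul-endo (suc n) = ∙-endo id-endo (mul-endo n)

  ρ-endo : IsEndomorphism ρ
  ρ-endo = record { cong = ρ-cong ; homo = ρ-hom }

  σ-endo : IsEndomorphism σ
  σ-endo = record { cong = σ-cong ; homo = σ-hom }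

  resDG-endo : IsEndomorphism resDG
  resDG-endo = ∙-endo id-endo σ-endo

  IsSumOf : ∀ {a} {A : Set a} → (A → Carrier) → Carrier → Set (a ⊔ ℓ)
  IsSumOf {A = A} f x = Σ (List A) λ l → x ≈ sumL (map f l)

  module _ {a} {A : Set a} {f : A → Carrier} where

    IsSumOf-resp-≈ : ∀ {x y} → x ≈ y → IsSumOf f x → IsSumOf f y
    IsSumOf-resp-≈ x≈y (l , x≈Σ) = l , trans (sym x≈y) x≈Σ

    IsSumOf-ε : IsSumOf f ε
    IsSumOf-ε = [] , refl

    IsSumOf-∙ : ∀ {x y} → IsSumOf f x → IsSumOf f y → IsSumOf f (x ∙ y)
    IsSumOf-∙ (l , x≈Σ) (m , y≈Σ) = l ++ m , (begin
      _ ∙ _                                ≈⟨ ∙-cong x≈Σ y≈Σ ⟩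
      sumL (map f l) ∙ sumL (map f m)      ≈⟨ sumL-++ (map f l) (map f m) ⟨
      sumL (map f l ++ map f m)            ≡⟨ ≡.cong sumL (map-++ f l m) ⟨
      sumL (map f (l ++ m))                ∎)

    IsSumOf-generator : ∀ a → IsSumOf f (f a)
    IsSumOf-generator a = [ a ] , sym (identityʳ _)

  module _ {a} {A : Set a} {f : A → Carrier} where

    IsSumOf-trans : ∀ {b} {C : Set b} {g : C → Carrier} →
                    (∀ a → IsSumOf g (f a)) → ∀ {x} → IsSumOf f x → IsSumOf g x
    IsSumOf-trans fa∈g (l , x≈Σ) =
      IsSumOf-resp-≈ (sym x≈Σ) (sumL-map-closed (IsSumOf _) IsSumOf-ε IsSumOf-∙ fa∈g l)

    IsSumOf-≈ε : (∀ a → f a ≈ ε) → ∀ {x} → IsSumOf f x → x ≈ ε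
    IsSumOf-≈ε fa≈ε (l , x≈Σ) =
      trans x≈Σ (sumL-map-closed (_≈ ε) refl (λ x≈ε y≈ε → trans (∙-cong x≈ε y≈ε) (identityʳ ε)) fa≈ε l)

    IsSumOf-image : ∀ {h} → IsEndomorphism h → ∀ {x} → IsSumOf f x → IsSumOf (h ∘ f) (h x)
    IsSumOf-image H (l , x≈Σ) = l , trans (cong H x≈Σ) (sumL-map-homo H f l)

  iter-fixed : ∀ {x} → ρ x ≈ x → ∀ n → iter n ρ x ≈ x
  iter-fixed ρx≈x zero    = refl
  iter-fixed ρx≈x (suc n) = trans (ρ-cong (iter-fixed ρx≈x n)) ρx≈x

  orbitSum : ℕ → Carrier → Carrier
  orbitSum zero    y = ε
  orbitSum (suc n) y = orbitSum n y ∙ iter n ρ y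

  orbitSum-endo : ∀ n → IsEndomorphism (orbitSum n)
  orbitSum-endo zero    = ε-endo
  orbitSum-endo (suc n) = ∙-endo (orbitSum-endo n) (iter-endo ρ-endo n)

  orbitSum-fixed : ∀ {x} → ρ x ≈ x → ∀ n → orbitSum n x ≈ mul n x
  orbitSum-fixed ρx≈x zero    = refl
  orbitSum-fixed ρx≈x (suc n) =
    trans (∙-cong (orbitSum-fixed ρx≈x n) (iter-fixed ρx≈x n)) (comm _ _)

  orbitSum-shift : ∀ n y → orbitSum n (ρ y) ∙ y ≈ orbitSum n y ∙ iter n ρ y
  orbitSum-shift zero    y = refl
  orbitSum-shift (suc n) y = begin
    (orbitSum n (ρ y) ∙ iter n ρ (ρ y)) ∙ y   ≈⟨ ∙-congʳ (∙-congˡ (≡⇒≈ (iter-suc ρ n y))) ⟩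
    (orbitSum n (ρ y) ∙ ρ (iter n ρ y)) ∙ y   ≈⟨ assoc _ _ _ ⟩
    orbitSum n (ρ y) ∙ (ρ (iter n ρ y) ∙ y)   ≈⟨ ∙-congˡ (comm _ _) ⟩
    orbitSum n (ρ y) ∙ (y ∙ ρ (iter n ρ y))   ≈⟨ assoc _ _ _ ⟨
    (orbitSum n (ρ y) ∙ y) ∙ ρ (iter n ρ y)   ≈⟨ ∙-congʳ (orbitSum-shift n y) ⟩
    (orbitSum n y ∙ iter n ρ y) ∙ ρ (iter n ρ y) ∎

  norm-ρ-invariant : ∀ y → orbitSum q (ρ y) ≈ orbitSum q y
  norm-ρ-invariant y = ∙-cancelʳ y _ _ (trans (orbitSum-shift q y) (∙-congˡ (ρ^q y)))

  norm-iter-invariant : ∀ n y → orbitSum q (iter n ρ y) ≈ orbitSum q y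
  norm-iter-invariant zero    y = refl
  norm-iter-invariant (suc n) y = trans (norm-ρ-invariant _) (norm-iter-invariant n y)

  norm-kills-difference : ∀ n y → orbitSum q (iter n ρ y ∙ y ⁻¹) ≈ ε
  norm-kills-difference n y = begin
    orbitSum q (iter n ρ y ∙ y ⁻¹)          ≈⟨ ∙⁻¹-homo (orbitSum-endo q) _ _ ⟩
    orbitSum q (iter n ρ y) ∙ orbitSum q y ⁻¹ ≈⟨ ∙-congʳ (norm-iter-invariant n y) ⟩
    orbitSum q y ∙ orbitSum q y ⁻¹          ≈⟨ inverseʳ _ ⟩
    ε                                       ∎

  σ-iter-ρ : ∀ i z → σ (iter i ρ z) ≈ iter (i * (q ∸ 1)) ρ (σ z)
  σ-iter-ρ zero    z = refl
  σ-iter-ρ (suc i) z = begin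
    σ (ρ (iter i ρ z))                            ≈⟨ σ-cong (ρ-cong (σ² _)) ⟨
    σ (ρ (σ (σ (iter i ρ z))))                    ≈⟨ σρσ _ ⟩
    iter (q ∸ 1) ρ (σ (iter i ρ z))               ≈⟨ cong (iter-endo ρ-endo (q ∸ 1)) (σ-iter-ρ i z) ⟩
    iter (q ∸ 1) ρ (iter (i * (q ∸ 1)) ρ (σ z))   ≡⟨ iter-+ ρ (q ∸ 1) (i * (q ∸ 1)) (σ z) ⟨
    iter (suc i * (q ∸ 1)) ρ (σ z)                ∎

  InvG∧σ-fixed⇒InvD : ∀ {x} → InvG x → σ x ≈ x → InvD x
  InvG∧σ-fixed⇒InvD inv σx≈x (g , false) = inv g
  InvG∧σ-fixed⇒InvD inv σx≈x (g , true)  = trans (cong (iter-endo ρ-endo (toℕ g)) σx≈x) (inv g)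

  InvD⇒σ-fixed : 0 < q → ∀ {x} → InvD x → σ x ≈ x
  InvD⇒σ-fixed 0<q {x} inv =
    ≡.subst (λ k → iter k ρ (σ x) ≈ x) (toℕ-fromℕ< 0<q) (inv (fromℕ< 0<q , true))

  length-elemsD : length elemsD ≡.≡ q + q
  length-elemsD = ≡.trans (length-++ (map (λ i → i , false) (allFin q)))
    (≡.cong₂ _+_ (≡.trans (length-map _ (allFin q)) (length-tabulate {n = q} id))
                 (≡.trans (length-map _ (allFin q)) (length-tabulate {n = q} id)))

  InBq∧InvD⇒ND≈ε : ∀ {x} → InBq x → InvD x → ND x ≈ ε
  InBq∧InvD⇒ND≈ε {x} qx≈ε inv = begin
    ND x                  ≈⟨ sumL-map-const inv elemsD ⟩
    mul (length elemsD) x ≡⟨ ≡.cong (λ n → mul n x) length-elemsD ⟩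
    mul (q + q) x         ≈⟨ mul-+ q q x ⟩
    mul q x ∙ mul q x     ≈⟨ ∙-cong qx≈ε qx≈ε ⟩
    ε ∙ ε                 ≈⟨ identityʳ ε ⟩
    ε                     ∎

  module _ (1<q : 1 < q) where

    InvG⇒ρ-fixed : ∀ {x} → InvG x → ρ x ≈ x
    InvG⇒ρ-fixed {x} inv = ≡.subst (λ k → iter k ρ x ≈ x) (toℕ-fromℕ< 1<q) (inv (fromℕ< 1<q))

    ρ-difference∈IGB : ∀ y → InIGB (ρ y ∙ y ⁻¹)
    ρ-difference∈IGB y = IsSumOf-resp-≈
      (∙-congʳ (≡⇒≈ (≡.cong (λ k → iter k ρ y) (toℕ-fromℕ< 1<q))))
      (IsSumOf-generator (fromℕ< 1<q , y))

    iter-difference∈IGB : ∀ n y → InIGB (iter n ρ y ∙ y ⁻¹)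
    iter-difference∈IGB zero    y = IsSumOf-resp-≈ (sym (inverseʳ y)) IsSumOf-ε
    iter-difference∈IGB (suc n) y = IsSumOf-resp-≈ (telescope y (iter n ρ y) _)
      (IsSumOf-∙ (iter-difference∈IGB n y) (ρ-difference∈IGB (iter n ρ y)))

    InIGB∧InvG⇒InBq : ∀ {x} → InIGB x → InvG x → InBq x
    InIGB∧InvG⇒InBq {x} x∈IGB inv = begin
      mul q x      ≈⟨ orbitSum-fixed (InvG⇒ρ-fixed inv) q ⟨
      orbitSum q x ≈⟨ IsSumOf-≈ε (λ { (g , y) → norm-kills-difference (toℕ g) y })
                                 (IsSumOf-image (orbitSum-endo q) x∈IGB) ⟩
      ε            ∎

    resDG-generator∈IGB : ∀ d y → InIGB (resDG (actD d y ∙ y ⁻¹))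
    resDG-generator∈IGB (g , false) y = IsSumOf-resp-≈
      (∙-congˡ (sym (trans (∙⁻¹-homo σ-endo _ _) (∙-congʳ (σ-iter-ρ (toℕ g) y)))))
      (IsSumOf-∙ (iter-difference∈IGB (toℕ g) y) (iter-difference∈IGB (toℕ g * (q ∸ 1)) (σ y)))
    resDG-generator∈IGB (g , true) y = IsSumOf-resp-≈ (begin
      (ρᵍ (σ y) ∙ σ y ⁻¹) ∙ (ρᵐ y ∙ y ⁻¹)      ≈⟨ swap _ _ _ _ ⟩
      (ρᵍ (σ y) ∙ y ⁻¹) ∙ (ρᵐ y ∙ σ y ⁻¹)      ≈⟨ ∙-congˡ (∙-congʳ (cong (iter-endo ρ-endo (toℕ g * (q ∸ 1))) (σ² y))) ⟨
      (ρᵍ (σ y) ∙ y ⁻¹) ∙ (ρᵐ (σ (σ y)) ∙ σ y ⁻¹) ≈⟨ ∙-congˡ (∙-congʳ (σ-iter-ρ (toℕ g) (σ y))) ⟨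
      (ρᵍ (σ y) ∙ y ⁻¹) ∙ (σ (ρᵍ (σ y)) ∙ σ y ⁻¹) ≈⟨ ∙-congˡ (∙⁻¹-homo σ-endo _ _) ⟨
      resDG (ρᵍ (σ y) ∙ y ⁻¹)                  ∎)
      (IsSumOf-∙ (iter-difference∈IGB (toℕ g) (σ y)) (iter-difference∈IGB (toℕ g * (q ∸ 1)) y))
      where
      ρᵍ ρᵐ : Carrier → Carrier
      ρᵍ = iter (toℕ g) ρ
      ρᵐ = iter (toℕ g * (q ∸ 1)) ρ
      swap : ∀ a b c d → (a ∙ b) ∙ (c ∙ d) ≈ (a ∙ d) ∙ (c ∙ b)
      swap a b c d = trans (∙-congˡ (comm c d)) (trans (interchange a b d c) (∙-congˡ (comm b c)))

    InIDB⇒resDG∈IGB : ∀ {b} → InIDB b → InIGB (resDG b)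
    InIDB⇒resDG∈IGB b∈IDB = IsSumOf-trans (λ { (d , y) → resDG-generator∈IGB d y })
                                           (IsSumOf-image resDG-endo b∈IDB)

  KerD⇒InIGB∧InBq∧InvD : 1 < q → (∀ x → InBq x → InvG x) →
                         ∀ {x} → KerD x → InIGB x × (InBq x × InvD x)
  KerD⇒InIGB∧InBq∧InvD 1<q InBq⇒InvG {x} (b , (qb≈ε , _ , b∈IDB) , b+σb≈x) =
    IsSumOf-resp-≈ b+σb≈x (InIDB⇒resDG∈IGB 1<q b∈IDB) ,
    qx≈ε , InvG∧σ-fixed⇒InvD (InBq⇒InvG x qx≈ε) σx≈x
    where
    qx≈ε : InBq x
    qx≈ε = begin
      mul q x          ≈⟨ cong (mul-endo q) b+σb≈x ⟨
      mul q (resDG b)  ≈⟨ mul-homo resDG-endo q b ⟨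
      resDG (mul q b)  ≈⟨ cong resDG-endo qb≈ε ⟩
      resDG ε          ≈⟨ ε-homo resDG-endo ⟩
      ε                ∎
    σx≈x : σ x ≈ x
    σx≈x = begin
      σ x            ≈⟨ σ-cong b+σb≈x ⟨
      σ (b ∙ σ b)    ≈⟨ σ-hom b (σ b) ⟩
      σ b ∙ σ (σ b)  ≈⟨ ∙-congˡ (σ² b) ⟩
      σ b ∙ b        ≈⟨ comm _ _ ⟩
      b ∙ σ b        ≈⟨ b+σb≈x ⟩
      x              ∎

  module Halving (u2 : Uniquely2Divisible) where

    half : Carrier → Carrier
    half y = proj₁ (proj₁ u2 y)

    half-double : ∀ y → half y ∙ half y ≈ y
    half-double y = proj₂ (proj₁ u2 y)

    double-injective : ∀ x y → x ∙ x ≈ y ∙ y → x ≈ y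
    double-injective = proj₂ u2

    half-endo : IsEndomorphism half
    half-endo = record
      { cong = λ {x} {y} x≈y → double-injective _ _
          (trans (half-double x) (trans x≈y (sym (half-double y))))
      ; homo = λ x y → double-injective _ _ (begin
          half (x ∙ y) ∙ half (x ∙ y)            ≈⟨ half-double (x ∙ y) ⟩
          x ∙ y                                  ≈⟨ ∙-cong (half-double x) (half-double y) ⟨
          (half x ∙ half x) ∙ (half y ∙ half y)  ≈⟨ interchange _ _ _ _ ⟩
          (half x ∙ half y) ∙ (half x ∙ half y)  ∎)
      }

    half-commutes : ∀ {f} → IsEndomorphism f → ∀ x → half (f x) ≈ f (half x)
    half-commutes {f} F x = double-injective _ _ (begin
      half (f x) ∙ half (f x)   ≈⟨ half-double _ ⟩
      f x                       ≈⟨ cong F (half-double x) ⟨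
      f (half x ∙ half x)       ≈⟨ homo F _ _ ⟩
      f (half x) ∙ f (half x)   ∎)

    half-generator : ∀ g y → half (actG g y ∙ y ⁻¹) ≈ actG g (half y) ∙ half y ⁻¹
    half-generator g y =
      trans (∙⁻¹-homo half-endo _ _) (∙-congʳ (half-commutes (iter-endo ρ-endo (toℕ g)) y))

    InIGB⇒half∈IDB : ∀ {x} → InIGB x → InIDB (half x)
    InIGB⇒half∈IDB x∈IGB = IsSumOf-trans
      (λ { (g , y) → IsSumOf-resp-≈ (sym (half-generator g y)) (IsSumOf-generator ((g , false) , half y)) })
      (IsSumOf-image half-endo x∈IGB)

    InIGB∧InBq∧InvD⇒KerD : 0 < q → (∀ x → InBq x → InvG x) →
                           ∀ {x} → InIGB x × (InBq x × InvD x) → KerD x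
    InIGB∧InBq∧InvD⇒KerD 0<q InBq⇒InvG {x} (x∈IGB , qx≈ε , inv) =
      half x , (qb≈ε , InBq∧InvD⇒ND≈ε qb≈ε invb , InIGB⇒half∈IDB x∈IGB) ,
      trans (∙-congˡ σb≈b) (half-double x)
      where
      σb≈b : σ (half x) ≈ half x
      σb≈b = trans (sym (half-commutes σ-endo x)) (cong half-endo (InvD⇒σ-fixed 0<q inv))
      qb≈ε : InBq (half x)
      qb≈ε = trans (sym (half-commutes (mul-endo q) x)) (trans (cong half-endo qx≈ε) (ε-homo half-endo))
      invb : InvD (half x)
      invb = InvG∧σ-fixed⇒InvD (InBq⇒InvG _ qb≈ε) σb≈b

-- The oddness of q is only needed for the identification of Ĥ⁻¹(D, B[q]) with B[q]ᴰ,
-- which is built into KerD.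
lemma2p8 : ∀ {c ℓ : Level} (q : ℕ) → 3 ≤ q → ¬ (2 ∣ q) →
    (M : DihedralModule q c ℓ) →
    let open DihedralModule M in
    (∀ x → InBq x → InvG x) →
    ((∀ x → KerG x ⇔ (InIGB x × (InBq x × InvG x)))
     × (∀ x → (InIGB x × (InBq x × InvG x)) ⇔ (InIGB x × InvG x)))
    × (Uniquely2Divisible →
       (∀ x → KerD x ⇔ (InIGB x × (InBq x × InvD x)))
       × (∀ x → (InIGB x × (InBq x × InvD x)) ⇔ (InIGB x × InvD x)))
lemma2p8 q 3≤q _ M InBq⇒InvG =
  ( (λ x → mk⇔ (λ (qx≈ε , x∈IGB) → x∈IGB , qx≈ε , InBq⇒InvG x qx≈ε)
               (λ (x∈IGB , qx≈ε , _) → qx≈ε , x∈IGB))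
  , (λ x → mk⇔ (λ (x∈IGB , _ , inv) → x∈IGB , inv)
               (λ (x∈IGB , inv) → x∈IGB , InIGB∧InvG⇒InBq 1<q x∈IGB inv , inv)) )
  , λ u2 →
    (λ x → mk⇔ (KerD⇒InIGB∧InBq∧InvD 1<q InBq⇒InvG)
               (Halving.InIGB∧InBq∧InvD⇒KerD u2 (<-trans z<s 1<q) InBq⇒InvG))
  , (λ x → mk⇔ (λ (x∈IGB , _ , inv) → x∈IGB , inv)
               (λ (x∈IGB , inv) → x∈IGB , InIGB∧InvG⇒InBq 1<q x∈IGB (inv ∘ (_, false)) , inv))
  where
  open DihedralModuleProperties M
  1<q : 1 < q
  1<q = ≤-trans (n≤1+n 2) 3≤q
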